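{- Let $f:\mathbb{Z}_+\to\mathbb{C}$ and $F(x)=1+\sum_{\ell=1}^\infty f(\ell)x^\ell$. Then for every $k\in\mathbb{Z}_+$ and $n\in\mathbb{Z}_{\geq0}$, \[c_n:=\sum_{C\in\mathcal{C}_n^{(k)}}\prod_{i=1}^{|\mathbf{u}(C)|}f(\mathbf{u}(C)_i)=\frac{1}{kn+1}[x^n]F(x)^{kn+1},\] and the generating function $C(x)=\sum_{n\geq0}c_nx^n$ satisfies $C(x)=F(xC(x)^k)$.
   Context: For $k\in\mathbb{Z}_+$, $\mathcal{C}_n^{(k)}$ (the $k$-Catalan paths of size $n$) is the set of lattice paths from $(0,0)$ to $((k+1)n,0)$ with step set $\{(1,k),(1,-1)\}$ that never go below the $x$-axis. For $C\in\mathcal{C}_n^{(k)}$, $\mathbf{u}(C)$ is the vector recording, in order, the lengths of the maximal blocks of consecutive $(1,k)$ steps in $C$. Empty products equal $1$; $[x^n]$ denotes coefficient extraction. -}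

module Defs where

open import Level using (Level)
open import Algebra.Bundles using (CommutativeRing)
open import Data.Bool using (Bool; true; false; _∧_)
open import Data.Nat using (ℕ; zero; suc; _∸_; _≡ᵇ_) renaming (_+_ to _+ℕ_; _*_ to _*ℕ_)
open import Data.List using (List; []; _∷_; _++_; length; map; filterᵇ; concatMap)

-- Steps of a lattice path: true = up step (1,k), false = down step (1,-1).

allPaths : ℕ → List (List Bool)
allPaths zero = [] ∷ []
allPaths (suc m) = concatMap (λ p → (true ∷ p) ∷ (false ∷ p) ∷ []) (allPaths m)

staysAbove : ℕ → ℕ → List Bool → Bool
staysAbove k zero [] = true
staysAbove k (suc h) [] = false
staysAbove k h (true ∷ p) = staysAbove k (h +ℕ k) p
staysAbove k zero (false ∷ p) = false
staysAbove k (suc h) (false ∷ p) = staysAbove k h p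

isCatalan : ℕ → ℕ → List Bool → Bool
isCatalan k n p = (length p ≡ᵇ (suc k *ℕ n)) ∧ staysAbove k zero p

catalanPaths : ℕ → ℕ → List (List Bool)
catalanPaths k n = filterᵇ (isCatalan k n) (allPaths (suc k *ℕ n))

-- u(C): lengths of maximal blocks of consecutive up steps, in order
emit : ℕ → List ℕ
emit zero = []
emit (suc m) = suc m ∷ []

runs : ℕ → List Bool → List ℕ
runs acc [] = emit acc
runs acc (true ∷ p) = runs (suc acc) p
runs acc (false ∷ p) = emit acc ++ runs zero p

u : List Bool → List ℕ
u = runs zero

module Series {c ℓ : Level} (R : CommutativeRing c ℓ) where
  open CommutativeRing R public hiding (zero)

  fromℕ : ℕ → Carrier
  fromℕ zero = 0#
  fromℕ (suc m) = 1# + fromℕ m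

  prodR : List Carrier → Carrier
  prodR [] = 1#
  prodR (x ∷ xs) = x * prodR xs

  sumR : List Carrier → Carrier
  sumR [] = 0#
  sumR (x ∷ xs) = x + sumR xs

  sumTo : ℕ → (ℕ → Carrier) → Carrier
  sumTo zero g = g zero
  sumTo (suc n) g = sumTo n g + g (suc n)

  PS : Set c
  PS = ℕ → Carrier

  oneS : PS
  oneS zero = 1#
  oneS (suc _) = 0#

  _⊛_ : PS → PS → PS
  (a ⊛ b) n = sumTo n (λ i → a i * b (n ∸ i))

  _^S_ : PS → ℕ → PS
  a ^S zero = oneS
  a ^S suc m = a ⊛ (a ^S m)

  shiftX : PS → PS
  shiftX a zero = 0#
  shiftX a (suc n) = a n

  -- composition F(G) for G with zero constant term:
  -- [x^n] F(G) = sum_{j=0}^{n} F_j [x^n] G^j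
  compose : PS → PS → PS
  compose F G n = sumTo n (λ j → F j * (G ^S j) n)

  -- F(x) = 1 + sum_{l ≥ 1} f(l) x^l   (f 0 is ignored)
  Fser : (ℕ → Carrier) → PS
  Fser f zero = 1#
  Fser f (suc l) = f (suc l)

  weight : (ℕ → Carrier) → List Bool → Carrier
  weight f p = prodR (map f (u p))

  cSeq : (ℕ → Carrier) → ℕ → PS
  cSeq f k n = sumR (map (weight f) (catalanPaths k n))

{-# OPTIONS --safe #-}
module Submission where

-- A path from height h down to 0 begins with an up-run of some length j (weight f j, or 1 if j = 0),
-- after which it is at height h + jk and either stops or steps down. So the series A_{h+1} of such
-- paths, counted by up steps, satisfies A_{h+1} = Σ_j f_j x^j A_{jk+h}, with A_0 = 1.
-- This recursion alone forces A_a A_b = A_{a+b}; hence A_m = C^m, and C = A_1 = F(x C^k).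
-- Multiplying the recursion by M = h + nk and using the power rule xD F^{M+1} = (M+1) F^M xD F
-- gives (m + nk) [x^n] A_m = m [x^n] F^{m+nk} by induction on n and then on m, after cancelling M;
-- m = 1 is the coefficient formula.

open import Defs
open import Level using (Level)
open import Algebra.Bundles using (CommutativeRing)
open import Data.Nat using (ℕ; zero; suc; _≤_; _<_; _∸_; _≡ᵇ_; z≤n; s≤s)
  renaming (_+_ to _+ℕ_; _*_ to _*ℕ_)
import Data.Nat.Properties as ℕ
open import Data.Nat.Induction using (<-rec)
open import Data.Nat.Solver using (module +-*-Solver)
open import Data.Bool using (Bool; true; false; if_then_else_; _∧_)
open import Data.Bool.Properties using (T-≡)
open import Data.List using (List; []; _∷_; map; length; filterᵇ; concatMap)
open import Data.Product using (_×_; _,_)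
open import Function.Bundles using (Equivalence)
open import Relation.Nullary using (yes; no)
open import Relation.Binary.PropositionalEquality as ≡ using (_≡_)
import Algebra.Properties.CommutativeSemigroup as CommutativeSemigroupProperties
import Algebra.Properties.Semiring.Mult as SemiringMultProperties

-- The induction principle of the recursion A_{h+1}[n] = Σ_{j ≤ n} F_j A_{jk+h}[n-j]: the j = 0 term
-- keeps n and lowers the index, every other term lowers n. Indices are written j * k + h so that
-- the j = 0 term is P h n on the nose.
recursion-induction : ∀ {p} (k : ℕ) (P : ℕ → ℕ → Set p) →
  (∀ n → P 0 n) →
  (∀ h n → (∀ j → j ≤ n → P (j *ℕ k +ℕ h) (n ∸ j)) → P (suc h) n) →
  ∀ m n → P m n
recursion-induction k P base step m n = <-rec (λ n → ∀ m → P m n) at n m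
  where
  at : ∀ n → (∀ {n′} → n′ < n → ∀ m → P m n′) → ∀ m → P m n
  at n ih zero = base n
  at n ih (suc h) = step h n summand
    where
    summand : ∀ j → j ≤ n → P (j *ℕ k +ℕ h) (n ∸ j)
    summand zero _ = at n ih h
    summand (suc j) j<n = ih (ℕ.∸-monoʳ-< (s≤s z≤n) j<n) (suc j *ℕ k +ℕ h)

recursion-index : ∀ k h {j n} → j ≤ n → j *ℕ k +ℕ h +ℕ (n ∸ j) *ℕ k ≡ h +ℕ n *ℕ k
recursion-index k h {j} {n} j≤n = begin
  j *ℕ k +ℕ h +ℕ (n ∸ j) *ℕ k    ≡⟨ ≡.cong (_+ℕ (n ∸ j) *ℕ k) (ℕ.+-comm (j *ℕ k) h) ⟩
  h +ℕ j *ℕ k +ℕ (n ∸ j) *ℕ k    ≡⟨ ℕ.+-assoc h (j *ℕ k) _ ⟩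
  h +ℕ (j *ℕ k +ℕ (n ∸ j) *ℕ k)  ≡⟨ ≡.cong (h +ℕ_) (ℕ.*-distribʳ-+ k j (n ∸ j)) ⟨
  h +ℕ (j +ℕ (n ∸ j)) *ℕ k       ≡⟨ ≡.cong (λ m → h +ℕ m *ℕ k) (ℕ.m+[n∸m]≡n j≤n) ⟩
  h +ℕ n *ℕ k                    ∎
  where open ≡.≡-Reasoning

remaining-length : ∀ k h {n j} → j ≤ n → h +ℕ n *ℕ suc k ∸ j ≡ j *ℕ k +ℕ h +ℕ (n ∸ j) *ℕ suc k
remaining-length k h {n} {j} j≤n = begin
  h +ℕ n *ℕ suc k ∸ j                       ≡⟨ ≡.cong (λ m → h +ℕ m *ℕ suc k ∸ j) (ℕ.m+[n∸m]≡n j≤n) ⟨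
  h +ℕ (j +ℕ (n ∸ j)) *ℕ suc k ∸ j          ≡⟨ ≡.cong (_∸ j) (rearrange h j k (n ∸ j)) ⟩
  j *ℕ k +ℕ h +ℕ (n ∸ j) *ℕ suc k +ℕ j ∸ j  ≡⟨ ℕ.m+n∸n≡m _ j ⟩
  j *ℕ k +ℕ h +ℕ (n ∸ j) *ℕ suc k           ∎
  where
  open ≡.≡-Reasoning
  open +-*-Solver
  rearrange : ∀ h j k r → h +ℕ (j +ℕ r) *ℕ suc k ≡ j *ℕ k +ℕ h +ℕ r *ℕ suc k +ℕ j
  rearrange = solve 4 (λ h j k r → h :+ (j :+ r) :* (con 1 :+ k) := j :* k :+ h :+ r :* (con 1 :+ k) :+ j) ≡.refl

remaining-length-short : ∀ k h {n j} → n < j → j ≤ h +ℕ n *ℕ suc k → h +ℕ n *ℕ suc k ∸ j < j *ℕ k +ℕ h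
remaining-length-short k h {n} {j} n<j j≤L =
  ≡.subst (h +ℕ n *ℕ suc k ∸ j <_) (ℕ.m+n∸n≡m (j *ℕ k +ℕ h) j) (ℕ.∸-monoˡ-< bound j≤L)
  where
  open +-*-Solver
  rearrange : ∀ h j k → h +ℕ j *ℕ suc k ≡ j *ℕ k +ℕ h +ℕ j
  rearrange = solve 3 (λ h j k → h :+ j :* (con 1 :+ k) := j :* k :+ h :+ j) ≡.refl
  bound : h +ℕ n *ℕ suc k < j *ℕ k +ℕ h +ℕ j
  bound = ≡.subst (h +ℕ n *ℕ suc k <_) (rearrange h j k) (ℕ.+-monoʳ-< h (ℕ.*-monoˡ-< (suc k) n<j))

module FiniteSums {c ℓ : Level} (R : CommutativeRing c ℓ) where
  open Series R
  open import Relation.Binary.Reasoning.Setoid setoid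
  open CommutativeSemigroupProperties +-commutativeSemigroup using (interchange)

  sumTo-cong : ∀ n {g h : ℕ → Carrier} → (∀ i → i ≤ n → g i ≈ h i) → sumTo n g ≈ sumTo n h
  sumTo-cong zero g≈h = g≈h 0 z≤n
  sumTo-cong (suc n) g≈h =
    +-cong (sumTo-cong n (λ i i≤n → g≈h i (ℕ.m≤n⇒m≤1+n i≤n))) (g≈h (suc n) ℕ.≤-refl)

  sumTo-distrib-+ : ∀ n (g h : ℕ → Carrier) → sumTo n (λ i → g i + h i) ≈ sumTo n g + sumTo n h
  sumTo-distrib-+ zero g h = refl
  sumTo-distrib-+ (suc n) g h = trans (+-congʳ (sumTo-distrib-+ n g h)) (interchange _ _ _ _)

  *-distribˡ-sumTo : ∀ n x (g : ℕ → Carrier) → x * sumTo n g ≈ sumTo n (λ i → x * g i)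
  *-distribˡ-sumTo zero x g = refl
  *-distribˡ-sumTo (suc n) x g = trans (distribˡ x _ _) (+-congʳ (*-distribˡ-sumTo n x g))

  *-distribʳ-sumTo : ∀ n x (g : ℕ → Carrier) → sumTo n g * x ≈ sumTo n (λ i → g i * x)
  *-distribʳ-sumTo zero x g = refl
  *-distribʳ-sumTo (suc n) x g = trans (distribʳ x _ _) (+-congʳ (*-distribʳ-sumTo n x g))

  sumTo-zero : ∀ n {g : ℕ → Carrier} → (∀ i → i ≤ n → g i ≈ 0#) → sumTo n g ≈ 0#
  sumTo-zero zero g≈0 = g≈0 0 z≤n
  sumTo-zero (suc n) g≈0 =
    trans (+-cong (sumTo-zero n (λ i i≤n → g≈0 i (ℕ.m≤n⇒m≤1+n i≤n))) (g≈0 (suc n) ℕ.≤-refl))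
          (+-identityˡ 0#)

  sumTo-sucˡ : ∀ n (g : ℕ → Carrier) → sumTo (suc n) g ≈ g 0 + sumTo n (λ i → g (suc i))
  sumTo-sucˡ zero g = refl
  sumTo-sucˡ (suc n) g = trans (+-congʳ (sumTo-sucˡ n g)) (+-assoc _ _ _)

  sumTo-reverse : ∀ n (g : ℕ → Carrier) → sumTo n g ≈ sumTo n (λ i → g (n ∸ i))
  sumTo-reverse zero g = refl
  sumTo-reverse (suc n) g = begin
    sumTo n g + g (suc n)                       ≈⟨ +-congʳ (sumTo-reverse n g) ⟩
    sumTo n (λ i → g (n ∸ i)) + g (suc n)       ≈⟨ +-comm _ _ ⟩
    g (suc n) + sumTo n (λ i → g (n ∸ i))       ≈⟨ sumTo-sucˡ n (λ i → g (suc n ∸ i)) ⟨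
    sumTo (suc n) (λ i → g (suc n ∸ i))         ∎

  sumTo-vanishing-tail : ∀ {n} L (g : ℕ → Carrier) → n ≤ L →
    (∀ j → n < j → j ≤ L → g j ≈ 0#) → sumTo L g ≈ sumTo n g
  sumTo-vanishing-tail zero g z≤n _ = refl
  sumTo-vanishing-tail {n} (suc L) g n≤L tail≈0 with n ℕ.≟ suc L
  ... | yes ≡.refl = refl
  ... | no n≢L = begin
    sumTo L g + g (suc L) ≈⟨ +-cong (sumTo-vanishing-tail L g n≤L′ tail′) (tail≈0 (suc L) n<L ℕ.≤-refl) ⟩
    sumTo n g + 0#        ≈⟨ +-identityʳ _ ⟩
    sumTo n g             ∎
    where
    n<L : n < suc L
    n<L = ℕ.≤∧≢⇒< n≤L n≢L
    n≤L′ : n ≤ L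
    n≤L′ = ℕ.≤-pred n<L
    tail′ : ∀ j → n < j → j ≤ L → g j ≈ 0#
    tail′ j n<j j≤L = tail≈0 j n<j (ℕ.m≤n⇒m≤1+n j≤L)

  sumTo-triangle : ∀ n (g : ℕ → ℕ → Carrier) →
    sumTo n (λ i → sumTo i (g i)) ≈ sumTo n (λ j → sumTo (n ∸ j) (λ l → g (j +ℕ l) j))
  sumTo-triangle zero g = refl
  sumTo-triangle (suc n) g = begin
    sumTo n (λ i → sumTo i (g i)) + sumTo (suc n) (g (suc n))
      ≈⟨ +-congʳ (sumTo-triangle n g) ⟩
    Tₙ + (sumTo n (g (suc n)) + g (suc n) (suc n))
      ≈⟨ +-assoc _ _ _ ⟨
    (Tₙ + sumTo n (g (suc n))) + g (suc n) (suc n)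
      ≈⟨ +-congʳ (trans (sumTo-cong n longer) (sumTo-distrib-+ n _ _)) ⟨
    sumTo n (λ j → sumTo (suc n ∸ j) (λ l → g (j +ℕ l) j)) + g (suc n) (suc n)
      ≡⟨ ≡.cong (sumTo n (λ j → sumTo (suc n ∸ j) (λ l → g (j +ℕ l) j)) +_) diagonal ⟨
    sumTo (suc n) (λ j → sumTo (suc n ∸ j) (λ l → g (j +ℕ l) j)) ∎
    where
    Tₙ = sumTo n (λ j → sumTo (n ∸ j) (λ l → g (j +ℕ l) j))
    diagonal : sumTo (n ∸ n) (λ l → g (suc n +ℕ l) (suc n)) ≡ g (suc n) (suc n)
    diagonal = ≡.trans (≡.cong (λ m → sumTo m (λ l → g (suc n +ℕ l) (suc n))) (ℕ.n∸n≡0 n))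
                       (≡.cong (λ i → g i (suc n)) (ℕ.+-identityʳ (suc n)))
    longer : ∀ j → j ≤ n →
      sumTo (suc n ∸ j) (λ l → g (j +ℕ l) j) ≈ sumTo (n ∸ j) (λ l → g (j +ℕ l) j) + g (suc n) j
    longer j j≤n = begin
      sumTo (suc n ∸ j) (λ l → g (j +ℕ l) j)
        ≡⟨ ≡.cong (λ m → sumTo m (λ l → g (j +ℕ l) j)) (ℕ.+-∸-assoc 1 j≤n) ⟩
      sumTo (n ∸ j) (λ l → g (j +ℕ l) j) + g (j +ℕ suc (n ∸ j)) j
        ≡⟨ ≡.cong (λ i → sumTo (n ∸ j) (λ l → g (j +ℕ l) j) + g i j)
                  (≡.trans (ℕ.+-suc j (n ∸ j)) (≡.cong suc (ℕ.m+[n∸m]≡n j≤n))) ⟩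
      sumTo (n ∸ j) (λ l → g (j +ℕ l) j) + g (suc n) j ∎

  sumR-distrib-+ : ∀ {A : Set} (g h : A → Carrier) xs →
    sumR (map (λ x → g x + h x) xs) ≈ sumR (map g xs) + sumR (map h xs)
  sumR-distrib-+ g h [] = sym (+-identityˡ 0#)
  sumR-distrib-+ g h (x ∷ xs) = trans (+-congˡ (sumR-distrib-+ g h xs)) (interchange _ _ _ _)

  *-distribˡ-sumR : ∀ {A : Set} x (g : A → Carrier) xs → x * sumR (map g xs) ≈ sumR (map (λ y → x * g y) xs)
  *-distribˡ-sumR x g [] = zeroʳ x
  *-distribˡ-sumR x g (y ∷ xs) = trans (distribˡ _ _ _) (+-congˡ (*-distribˡ-sumR x g xs))

  sumR-zero : ∀ {A : Set} (xs : List A) → sumR (map (λ _ → 0#) xs) ≈ 0#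
  sumR-zero [] = refl
  sumR-zero (x ∷ xs) = trans (+-congˡ (sumR-zero xs)) (+-identityˡ 0#)

  sumR-filterᵇ : ∀ {A : Set} (P : A → Bool) (g : A → Carrier) xs →
    sumR (map g (filterᵇ P xs)) ≈ sumR (map (λ x → if P x then g x else 0#) xs)
  sumR-filterᵇ P g [] = refl
  sumR-filterᵇ P g (x ∷ xs) with P x
  ... | true = +-congˡ (sumR-filterᵇ P g xs)
  ... | false = trans (sumR-filterᵇ P g xs) (sym (+-identityˡ _))

  if-scale : ∀ b {x y z} → x ≈ y * z → (if b then x else 0#) ≈ y * (if b then z else 0#)
  if-scale true x≈yz = x≈yz
  if-scale false {y = y} _ = sym (zeroʳ y)

module Scalars {c ℓ : Level} (R : CommutativeRing c ℓ) where
  open Series R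
  open import Relation.Binary.Reasoning.Setoid setoid
  open SemiringMultProperties semiring using (×-homo-+; ×1-homo-*) renaming (_×_ to _×′_)

  fromℕ≡×1# : ∀ n → fromℕ n ≡ n ×′ 1#
  fromℕ≡×1# zero = ≡.refl
  fromℕ≡×1# (suc n) = ≡.cong (1# +_) (fromℕ≡×1# n)

  fromℕ-+ : ∀ m n → fromℕ (m +ℕ n) ≈ fromℕ m + fromℕ n
  fromℕ-+ m n rewrite fromℕ≡×1# (m +ℕ n) | fromℕ≡×1# m | fromℕ≡×1# n = ×-homo-+ 1# m n

  fromℕ-* : ∀ m n → fromℕ (m *ℕ n) ≈ fromℕ m * fromℕ n
  fromℕ-* m n rewrite fromℕ≡×1# (m *ℕ n) | fromℕ≡×1# m | fromℕ≡×1# n = ×1-homo-* m n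

  module Inverses (inv : ℕ → Carrier) (inv-correct : ∀ m → inv m * fromℕ (suc m) ≈ 1#) where

    inv-*-cancelˡ : ∀ m x → inv m * (fromℕ (suc m) * x) ≈ x
    inv-*-cancelˡ m x = begin
      inv m * (fromℕ (suc m) * x)  ≈⟨ *-assoc _ _ _ ⟨
      (inv m * fromℕ (suc m)) * x  ≈⟨ *-congʳ (inv-correct m) ⟩
      1# * x                       ≈⟨ *-identityˡ x ⟩
      x                            ∎

    fromℕ-cancelˡ : ∀ {m x y} → 1 ≤ m → fromℕ m * x ≈ fromℕ m * y → x ≈ y
    fromℕ-cancelˡ {suc m} {x} {y} _ mx≈my = begin
      x                            ≈⟨ inv-*-cancelˡ m x ⟨
      inv m * (fromℕ (suc m) * x)  ≈⟨ *-congˡ mx≈my ⟩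
      inv m * (fromℕ (suc m) * y)  ≈⟨ inv-*-cancelˡ m y ⟩
      y                            ∎

module PowerSeries {c ℓ : Level} (R : CommutativeRing c ℓ) where
  open Series R
  open FiniteSums R
  open Scalars R
  open import Relation.Binary.Reasoning.Setoid setoid
  open CommutativeSemigroupProperties *-commutativeSemigroup using (x∙yz≈y∙xz)

  infix 4 _≋_
  _≋_ : PS → PS → Set ℓ
  a ≋ b = ∀ n → a n ≈ b n

  infixl 6 _⊕_
  infixr 7 _•_

  _⊕_ : PS → PS → PS
  (a ⊕ b) n = a n + b n

  _•_ : Carrier → PS → PS
  (x • a) n = x * a n

  xD : PS → PS
  xD a n = fromℕ n * a n

  -- a ⊛ᶠ X is Σ_j a_j x^j X_j; the constant family X_j = b gives a ⊛ b.
  _⊛ᶠ_ : PS → (ℕ → PS) → PS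
  (a ⊛ᶠ X) n = sumTo n (λ j → a j * X j (n ∸ j))

  ⊛ᶠ-congˡ : ∀ a (X Y : ℕ → PS) n → (∀ j → j ≤ n → X j (n ∸ j) ≈ Y j (n ∸ j)) →
    (a ⊛ᶠ X) n ≈ (a ⊛ᶠ Y) n
  ⊛ᶠ-congˡ a X Y n X≈Y = sumTo-cong n (λ j j≤n → *-congˡ (X≈Y j j≤n))

  ⊛-congˡ : ∀ a {b b′} → b ≋ b′ → a ⊛ b ≋ a ⊛ b′
  ⊛-congˡ a b≋b′ n = sumTo-cong n (λ j _ → *-congˡ (b≋b′ (n ∸ j)))

  ⊛-congʳ : ∀ {a a′} b → a ≋ a′ → a ⊛ b ≋ a′ ⊛ b
  ⊛-congʳ b a≋a′ n = sumTo-cong n (λ i _ → *-congʳ (a≋a′ i))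

  ^S-cong : ∀ {a b} m → a ≋ b → a ^S m ≋ b ^S m
  ^S-cong zero a≋b n = refl
  ^S-cong {a} {b} (suc m) a≋b n = trans (⊛-congʳ (a ^S m) a≋b n) (⊛-congˡ b (^S-cong m a≋b) n)

  ⊛ᶠ-⊛-assoc : ∀ a (X : ℕ → PS) b → (a ⊛ᶠ X) ⊛ b ≋ a ⊛ᶠ (λ j → X j ⊛ b)
  ⊛ᶠ-⊛-assoc a X b n = begin
    sumTo n (λ i → sumTo i (λ j → a j * X j (i ∸ j)) * b (n ∸ i))
      ≈⟨ sumTo-cong n (λ i _ → *-distribʳ-sumTo i (b (n ∸ i)) _) ⟩
    sumTo n (λ i → sumTo i (λ j → (a j * X j (i ∸ j)) * b (n ∸ i)))
      ≈⟨ sumTo-triangle n (λ i j → (a j * X j (i ∸ j)) * b (n ∸ i)) ⟩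
    sumTo n (λ j → sumTo (n ∸ j) (λ l → (a j * X j (j +ℕ l ∸ j)) * b (n ∸ (j +ℕ l))))
      ≈⟨ sumTo-cong n (λ j _ → trans (*-distribˡ-sumTo (n ∸ j) (a j) _)
                                     (sumTo-cong (n ∸ j) (λ l _ → reindex j l))) ⟨
    sumTo n (λ j → a j * (X j ⊛ b) (n ∸ j)) ∎
    where
    reindex : ∀ j l → a j * (X j l * b (n ∸ j ∸ l)) ≈ (a j * X j (j +ℕ l ∸ j)) * b (n ∸ (j +ℕ l))
    reindex j l = trans (sym (*-assoc _ _ _))
      (reflexive (≡.cong₂ (λ u v → (a j * X j u) * b v) (≡.sym (ℕ.m+n∸m≡n j l)) (ℕ.∸-+-assoc n j l)))

  ⊛-assoc : ∀ a b e → (a ⊛ b) ⊛ e ≋ a ⊛ (b ⊛ e)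
  ⊛-assoc a b = ⊛ᶠ-⊛-assoc a (λ _ → b)

  ⊛-comm : ∀ a b → a ⊛ b ≋ b ⊛ a
  ⊛-comm a b n = trans (sumTo-reverse n _)
    (sumTo-cong n (λ i i≤n → trans (*-comm _ _)
                                   (reflexive (≡.cong (λ m → b m * a (n ∸ i)) (ℕ.m∸[m∸n]≡n i≤n)))))

  x⊛yz≋y⊛xz : ∀ a b e → a ⊛ (b ⊛ e) ≋ b ⊛ (a ⊛ e)
  x⊛yz≋y⊛xz a b e n = begin
    (a ⊛ (b ⊛ e)) n  ≈⟨ ⊛-assoc a b e n ⟨
    ((a ⊛ b) ⊛ e) n  ≈⟨ ⊛-congʳ e (⊛-comm a b) n ⟩
    ((b ⊛ a) ⊛ e) n  ≈⟨ ⊛-assoc b a e n ⟩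
    (b ⊛ (a ⊛ e)) n  ∎

  ⊛-identityˡ : ∀ b → oneS ⊛ b ≋ b
  ⊛-identityˡ b zero = *-identityˡ _
  ⊛-identityˡ b (suc n) = begin
    (oneS ⊛ b) (suc n)                               ≈⟨ sumTo-sucˡ n _ ⟩
    1# * b (suc n) + sumTo n (λ i → 0# * b (n ∸ i))  ≈⟨ +-cong (*-identityˡ _) (sumTo-zero n (λ i _ → zeroˡ _)) ⟩
    b (suc n) + 0#                                   ≈⟨ +-identityʳ _ ⟩
    b (suc n)                                        ∎

  ⊛-identityʳ : ∀ a → a ⊛ oneS ≋ a
  ⊛-identityʳ a n = trans (⊛-comm a oneS n) (⊛-identityˡ a n)

  ⊛-distribʳ-⊕ : ∀ a b e → (a ⊕ b) ⊛ e ≋ (a ⊛ e) ⊕ (b ⊛ e)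
  ⊛-distribʳ-⊕ a b e n = trans (sumTo-cong n (λ i _ → distribʳ _ _ _)) (sumTo-distrib-+ n _ _)

  •-⊛ : ∀ x a b → (x • a) ⊛ b ≋ x • (a ⊛ b)
  •-⊛ x a b n = trans (sumTo-cong n (λ i _ → *-assoc x (a i) _)) (sym (*-distribˡ-sumTo n x _))

  ⊛-• : ∀ a x b → a ⊛ (x • b) ≋ x • (a ⊛ b)
  ⊛-• a x b n = trans (sumTo-cong n (λ i _ → x∙yz≈y∙xz (a i) x _)) (sym (*-distribˡ-sumTo n x _))

  xD-⊛ : ∀ a b → xD (a ⊛ b) ≋ (xD a ⊛ b) ⊕ (a ⊛ xD b)
  xD-⊛ a b n = trans (*-distribˡ-sumTo n (fromℕ n) _) (trans (sumTo-cong n split) (sumTo-distrib-+ n _ _))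
    where
    split : ∀ i → i ≤ n →
      fromℕ n * (a i * b (n ∸ i)) ≈ (fromℕ i * a i) * b (n ∸ i) + a i * (fromℕ (n ∸ i) * b (n ∸ i))
    split i i≤n = begin
      fromℕ n * (a i * b (n ∸ i))
        ≡⟨ ≡.cong (λ m → fromℕ m * (a i * b (n ∸ i))) (ℕ.m+[n∸m]≡n i≤n) ⟨
      fromℕ (i +ℕ (n ∸ i)) * (a i * b (n ∸ i))
        ≈⟨ trans (*-congʳ (fromℕ-+ i (n ∸ i))) (distribʳ _ _ _) ⟩
      fromℕ i * (a i * b (n ∸ i)) + fromℕ (n ∸ i) * (a i * b (n ∸ i))
        ≈⟨ +-cong (sym (*-assoc _ _ _)) (x∙yz≈y∙xz _ _ _) ⟩
      (fromℕ i * a i) * b (n ∸ i) + a i * (fromℕ (n ∸ i) * b (n ∸ i)) ∎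

  xD-^S : ∀ a M → xD (a ^S suc M) ≋ fromℕ (suc M) • (xD a ⊛ (a ^S M))
  xD-^S a zero n = begin
    fromℕ n * (a ⊛ oneS) n   ≈⟨ *-congˡ (⊛-identityʳ a n) ⟩
    xD a n                   ≈⟨ ⊛-identityʳ (xD a) n ⟨
    (xD a ⊛ oneS) n          ≈⟨ trans (*-congʳ (+-identityʳ 1#)) (*-identityˡ _) ⟨
    (1# + 0#) * (xD a ⊛ oneS) n ∎
  xD-^S a (suc M) n = begin
    xD (a ⊛ (a ^S suc M)) n
      ≈⟨ xD-⊛ a (a ^S suc M) n ⟩
    (xD a ⊛ (a ^S suc M)) n + (a ⊛ xD (a ^S suc M)) n
      ≈⟨ +-congˡ (trans (⊛-congˡ a (xD-^S a M) n) (⊛-• a (fromℕ (suc M)) (xD a ⊛ (a ^S M)) n)) ⟩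
    (xD a ⊛ (a ^S suc M)) n + fromℕ (suc M) * (a ⊛ (xD a ⊛ (a ^S M))) n
      ≈⟨ +-congˡ (*-congˡ (x⊛yz≋y⊛xz a (xD a) (a ^S M) n)) ⟩
    (xD a ⊛ (a ^S suc M)) n + fromℕ (suc M) * (xD a ⊛ (a ^S suc M)) n
      ≈⟨ +-congʳ (*-identityˡ _) ⟨
    1# * (xD a ⊛ (a ^S suc M)) n + fromℕ (suc M) * (xD a ⊛ (a ^S suc M)) n
      ≈⟨ distribʳ _ _ _ ⟨
    fromℕ (suc (suc M)) * (xD a ⊛ (a ^S suc M)) n ∎

  shiftX-cong : ∀ {a b} → a ≋ b → shiftX a ≋ shiftX b
  shiftX-cong a≋b zero = refl
  shiftX-cong a≋b (suc n) = a≋b n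

  shiftX-⊛ˡ : ∀ a b → shiftX a ⊛ b ≋ shiftX (a ⊛ b)
  shiftX-⊛ˡ a b zero = zeroˡ _
  shiftX-⊛ˡ a b (suc n) = trans (sumTo-sucˡ n _) (trans (+-congʳ (zeroˡ _)) (+-identityˡ _))

  shiftX-⊛ʳ : ∀ a b → a ⊛ shiftX b ≋ shiftX (a ⊛ b)
  shiftX-⊛ʳ a b zero = zeroʳ _
  shiftX-⊛ʳ a b (suc n) = trans (+-cong (sumTo-cong n lower) last) (+-identityʳ _)
    where
    lower : ∀ i → i ≤ n → a i * shiftX b (suc n ∸ i) ≈ a i * b (n ∸ i)
    lower i i≤n = reflexive (≡.cong (λ m → a i * shiftX b m) (ℕ.+-∸-assoc 1 i≤n))
    last : a (suc n) * shiftX b (n ∸ n) ≈ 0#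
    last = trans (*-congˡ (reflexive (≡.cong (shiftX b) (ℕ.n∸n≡0 n)))) (zeroʳ _)

  shiftXⁿ : ℕ → PS → PS
  shiftXⁿ zero a = a
  shiftXⁿ (suc j) a = shiftX (shiftXⁿ j a)

  shiftXⁿ-+ : ∀ j a m → shiftXⁿ j a (j +ℕ m) ≡ a m
  shiftXⁿ-+ zero a m = ≡.refl
  shiftXⁿ-+ (suc j) a m = shiftXⁿ-+ j a m

  shiftXⁿ-⊛ʳ : ∀ j a b → a ⊛ shiftXⁿ j b ≋ shiftXⁿ j (a ⊛ b)
  shiftXⁿ-⊛ʳ zero a b n = refl
  shiftXⁿ-⊛ʳ (suc j) a b n = trans (shiftX-⊛ʳ a (shiftXⁿ j b) n) (shiftX-cong (shiftXⁿ-⊛ʳ j a b) n)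

  shiftX-^S : ∀ j a → shiftX a ^S j ≋ shiftXⁿ j (a ^S j)
  shiftX-^S zero a n = refl
  shiftX-^S (suc j) a n = begin
    (shiftX a ⊛ (shiftX a ^S j)) n               ≈⟨ ⊛-congˡ (shiftX a) (shiftX-^S j a) n ⟩
    (shiftX a ⊛ shiftXⁿ j (a ^S j)) n          ≈⟨ shiftX-⊛ˡ a (shiftXⁿ j (a ^S j)) n ⟩
    shiftX (a ⊛ shiftXⁿ j (a ^S j)) n          ≈⟨ shiftX-cong (shiftXⁿ-⊛ʳ j a (a ^S j)) n ⟩
    shiftXⁿ (suc j) (a ^S suc j) n             ∎

  compose-congʳ : ∀ F {G G′} → G ≋ G′ → compose F G ≋ compose F G′
  compose-congʳ F G≋G′ n = sumTo-cong n (λ j _ → *-congˡ (^S-cong j G≋G′ n))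

  compose-shiftX : ∀ F B → compose F (shiftX B) ≋ F ⊛ᶠ (λ j → B ^S j)
  compose-shiftX F B n = sumTo-cong n (λ j j≤n → *-congˡ (begin
    (shiftX B ^S j) n                     ≈⟨ shiftX-^S j B n ⟩
    shiftXⁿ j (B ^S j) n                  ≡⟨ ≡.cong (shiftXⁿ j (B ^S j)) (ℕ.m+[n∸m]≡n j≤n) ⟨
    shiftXⁿ j (B ^S j) (j +ℕ (n ∸ j))     ≡⟨ shiftXⁿ-+ j (B ^S j) (n ∸ j) ⟩
    (B ^S j) (n ∸ j)                      ∎))

module Recursion {c ℓ : Level} (R : CommutativeRing c ℓ) where
  open Series R
  open FiniteSums R
  open Scalars R
  open PowerSeries R
  open import Relation.Binary.Reasoning.Setoid setoid
  open CommutativeSemigroupProperties *-commutativeSemigroup using (x∙yz≈y∙xz)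
  open import Algebra.Solver.Ring.NaturalCoefficients.Default commutativeSemiring using (solve; _:+_; _:*_; _:=_)

  lagrange-identity : ∀ {m h n k a H D} → m ≈ h + n * k → m * a ≈ h * H + k * D →
    (1# + m) * D ≈ n * H → m * ((1# + m) * a) ≈ m * ((1# + h) * H)
  lagrange-identity {m} {h} {n} {k} {a} {H} {D} m≈ ma≈ D≈ = begin
    m * ((1# + m) * a)                          ≈⟨ x∙yz≈y∙xz m _ a ⟩
    (1# + m) * (m * a)                          ≈⟨ *-congˡ ma≈ ⟩
    (1# + m) * (h * H + k * D)                  ≈⟨ spread (1# + m) h k H D ⟩
    h * ((1# + m) * H) + k * ((1# + m) * D)
      ≈⟨ +-cong (*-congˡ (trans ([1+x]y≈y+xy m H) (+-congˡ (*-congʳ m≈)))) (*-congˡ D≈) ⟩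
    h * (H + (h + n * k) * H) + k * (n * H)     ≈⟨ collect h n k H ⟩
    (h + n * k) * (H + h * H)                   ≈⟨ *-cong m≈ ([1+x]y≈y+xy h H) ⟨
    m * ((1# + h) * H)                          ∎
    where
    [1+x]y≈y+xy : ∀ x y → (1# + x) * y ≈ y + x * y
    [1+x]y≈y+xy x y = trans (distribʳ y 1# x) (+-congʳ (*-identityˡ y))
    spread : ∀ s h k H D → s * (h * H + k * D) ≈ h * (s * H) + k * (s * D)
    spread = solve 5 (λ s h k H D → s :* (h :* H :+ k :* D) := (h :* (s :* H) :+ k :* (s :* D))) refl
    collect : ∀ h n k H → h * (H + (h + n * k) * H) + k * (n * H) ≈ (h + n * k) * (H + h * H)
    collect = solve 4 (λ h n k H →
      (h :* (H :+ (h :+ n :* k) :* H) :+ k :* (n :* H)) := (h :+ n :* k) :* (H :+ h :* H)) refl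

  module Solution (F : PS) (k : ℕ) (A : ℕ → PS) (A-zero : A 0 ≋ oneS)
                  (A-suc : ∀ h → A (suc h) ≋ F ⊛ᶠ (λ j → A (j *ℕ k +ℕ h))) where

    A-⊛ : ∀ a b → A a ⊛ A b ≋ A (a +ℕ b)
    A-⊛ a b n = recursion-induction k (λ a n → ∀ b → (A a ⊛ A b) n ≈ A (a +ℕ b) n) base step a n b
      where
      base : ∀ n b → (A 0 ⊛ A b) n ≈ A b n
      base n b = trans (⊛-congʳ (A b) A-zero n) (⊛-identityˡ (A b) n)
      step : ∀ h n →
        (∀ j → j ≤ n → ∀ b → (A (j *ℕ k +ℕ h) ⊛ A b) (n ∸ j) ≈ A (j *ℕ k +ℕ h +ℕ b) (n ∸ j)) →
        ∀ b → (A (suc h) ⊛ A b) n ≈ A (suc h +ℕ b) n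
      step h n ih b = begin
        (A (suc h) ⊛ A b) n                               ≈⟨ ⊛-congʳ (A b) (A-suc h) n ⟩
        ((F ⊛ᶠ (λ j → A (j *ℕ k +ℕ h))) ⊛ A b) n          ≈⟨ ⊛ᶠ-⊛-assoc F _ (A b) n ⟩
        (F ⊛ᶠ (λ j → A (j *ℕ k +ℕ h) ⊛ A b)) n
          ≈⟨ ⊛ᶠ-congˡ F (λ j → A (j *ℕ k +ℕ h) ⊛ A b) (λ j → A (j *ℕ k +ℕ (h +ℕ b))) n summand ⟩
        (F ⊛ᶠ (λ j → A (j *ℕ k +ℕ (h +ℕ b)))) n           ≈⟨ A-suc (h +ℕ b) n ⟨
        A (suc h +ℕ b) n                                  ∎
        where
        summand : ∀ j → j ≤ n → (A (j *ℕ k +ℕ h) ⊛ A b) (n ∸ j) ≈ A (j *ℕ k +ℕ (h +ℕ b)) (n ∸ j)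
        summand j j≤n = trans (ih j j≤n b) (reflexive (≡.cong (λ i → A i (n ∸ j)) (ℕ.+-assoc (j *ℕ k) h b)))

    A-^S : ∀ m j → A m ^S j ≋ A (j *ℕ m)
    A-^S m zero n = sym (A-zero n)
    A-^S m (suc j) n = trans (⊛-congˡ (A m) (A-^S m j) n) (A-⊛ m (j *ℕ m) n)

    A₁-functional-equation : A 1 ≋ compose F (shiftX (A 1 ^S k))
    A₁-functional-equation n = begin
      A 1 n                                  ≈⟨ A-suc 0 n ⟩
      (F ⊛ᶠ (λ j → A (j *ℕ k +ℕ 0))) n
        ≈⟨ ⊛ᶠ-congˡ F (λ j → A (j *ℕ k +ℕ 0)) (λ j → (A 1 ^S k) ^S j) n (λ j _ → powers j (n ∸ j)) ⟩
      (F ⊛ᶠ (λ j → (A 1 ^S k) ^S j)) n       ≈⟨ compose-shiftX F (A 1 ^S k) n ⟨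
      compose F (shiftX (A 1 ^S k)) n        ∎
      where
      A₁^k≋A : A 1 ^S k ≋ A k
      A₁^k≋A m = trans (A-^S 1 k m) (reflexive (≡.cong (λ i → A i m) (ℕ.*-identityʳ k)))
      powers : ∀ j → A (j *ℕ k +ℕ 0) ≋ (A 1 ^S k) ^S j
      powers j m = begin
        A (j *ℕ k +ℕ 0) m     ≡⟨ ≡.cong (λ i → A i m) (ℕ.+-identityʳ (j *ℕ k)) ⟩
        A (j *ℕ k) m          ≈⟨ A-^S k j m ⟨
        (A k ^S j) m          ≈⟨ ^S-cong j A₁^k≋A m ⟨
        ((A 1 ^S k) ^S j) m   ∎

    module Lagrange (inv : ℕ → Carrier) (inv-correct : ∀ m → inv m * fromℕ (suc m) ≈ 1#) (1≤k : 1 ≤ k) where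
      open Inverses inv inv-correct

      ScaledAt : ℕ → ℕ → ℕ → Set ℓ
      ScaledAt N m n = fromℕ N * A m n ≈ fromℕ m * (F ^S N) n

      LagrangeAt : ℕ → ℕ → Set ℓ
      LagrangeAt m n = ScaledAt (m +ℕ n *ℕ k) m n

      lagrange-zero : ∀ n → LagrangeAt 0 n
      lagrange-zero zero = trans (zeroˡ _) (sym (zeroˡ _))
      lagrange-zero (suc n) = trans (*-congˡ (A-zero (suc n))) (trans (zeroʳ _) (sym (zeroˡ _)))

      -- By induction the j-th summand becomes (jk + h) F_j [x^(n-j)] F^M, and (jk + h) F_j = h F_j + k (xD F)_j.
      scaled-recursion : ∀ h n → (∀ j → j ≤ n → LagrangeAt (j *ℕ k +ℕ h) (n ∸ j)) →
        fromℕ (h +ℕ n *ℕ k) * A (suc h) n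
          ≈ fromℕ h * (F ^S suc (h +ℕ n *ℕ k)) n + fromℕ k * (xD F ⊛ (F ^S (h +ℕ n *ℕ k))) n
      scaled-recursion h n ih = begin
        fromℕ M * A (suc h) n
          ≈⟨ *-congˡ (A-suc h n) ⟩
        fromℕ M * (F ⊛ᶠ (λ j → A (j *ℕ k +ℕ h))) n
          ≈⟨ *-distribˡ-sumTo n (fromℕ M) _ ⟩
        sumTo n (λ j → fromℕ M * (F j * A (j *ℕ k +ℕ h) (n ∸ j)))
          ≈⟨ sumTo-cong n summand ⟩
        ((fromℕ h • F ⊕ fromℕ k • xD F) ⊛ G) n
          ≈⟨ ⊛-distribʳ-⊕ (fromℕ h • F) (fromℕ k • xD F) G n ⟩
        ((fromℕ h • F) ⊛ G) n + ((fromℕ k • xD F) ⊛ G) n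
          ≈⟨ +-cong (•-⊛ (fromℕ h) F G n) (•-⊛ (fromℕ k) (xD F) G n) ⟩
        fromℕ h * (F ⊛ G) n + fromℕ k * (xD F ⊛ G) n ∎
        where
        M = h +ℕ n *ℕ k
        G = F ^S M
        weights : ∀ j f g →
          f * ((fromℕ j * fromℕ k + fromℕ h) * g) ≈ (fromℕ h * f + fromℕ k * (fromℕ j * f)) * g
        weights j = solve 5 (λ j k h f g →
          f :* ((j :* k :+ h) :* g) := (h :* f :+ k :* (j :* f)) :* g) refl (fromℕ j) (fromℕ k) (fromℕ h)
        summand : ∀ j → j ≤ n → fromℕ M * (F j * A (j *ℕ k +ℕ h) (n ∸ j))
                                 ≈ (fromℕ h * F j + fromℕ k * (fromℕ j * F j)) * G (n ∸ j)
        summand j j≤n = begin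
          fromℕ M * (F j * A (j *ℕ k +ℕ h) (n ∸ j))
            ≈⟨ x∙yz≈y∙xz _ _ _ ⟩
          F j * (fromℕ M * A (j *ℕ k +ℕ h) (n ∸ j))
            ≈⟨ *-congˡ (≡.subst (λ N → ScaledAt N (j *ℕ k +ℕ h) (n ∸ j))
                                (recursion-index k h j≤n) (ih j j≤n)) ⟩
          F j * (fromℕ (j *ℕ k +ℕ h) * G (n ∸ j))
            ≈⟨ *-congˡ (*-congʳ (trans (fromℕ-+ (j *ℕ k) h) (+-congʳ (fromℕ-* j k)))) ⟩
          F j * ((fromℕ j * fromℕ k + fromℕ h) * G (n ∸ j))
            ≈⟨ weights j (F j) (G (n ∸ j)) ⟩
          (fromℕ h * F j + fromℕ k * (fromℕ j * F j)) * G (n ∸ j) ∎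

      lagrange-suc-positive : ∀ h n → 1 ≤ h +ℕ n *ℕ k →
        (∀ j → j ≤ n → LagrangeAt (j *ℕ k +ℕ h) (n ∸ j)) → LagrangeAt (suc h) n
      lagrange-suc-positive h n 1≤M ih = fromℕ-cancelˡ 1≤M (lagrange-identity
        (trans (fromℕ-+ h (n *ℕ k)) (+-congˡ (fromℕ-* n k)))
        (scaled-recursion h n ih)
        (sym (xD-^S F (h +ℕ n *ℕ k) n)))

      -- Cancelling h + nk needs it nonzero, which fails only for h = n = 0 (this is where 1 ≤ k enters).
      lagrange-suc : ∀ h n → (∀ j → j ≤ n → LagrangeAt (j *ℕ k +ℕ h) (n ∸ j)) → LagrangeAt (suc h) n
      lagrange-suc (suc h) n = lagrange-suc-positive (suc h) n (s≤s z≤n)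
      lagrange-suc zero (suc n) = lagrange-suc-positive zero (suc n) (ℕ.≤-trans 1≤k (ℕ.m≤m+n k (n *ℕ k)))
      lagrange-suc zero zero _ = *-congˡ (trans (A-suc 0 0) (*-congˡ (A-zero 0)))

      lagrange : ∀ m n → LagrangeAt m n
      lagrange = recursion-induction k LagrangeAt lagrange-zero lagrange-suc

      A₁-coefficient : ∀ n → A 1 n ≈ inv (k *ℕ n) * (F ^S suc (k *ℕ n)) n
      A₁-coefficient n rewrite ℕ.*-comm k n = begin
        A 1 n                                         ≈⟨ inv-*-cancelˡ (n *ℕ k) (A 1 n) ⟨
        inv (n *ℕ k) * (fromℕ (suc (n *ℕ k)) * A 1 n) ≈⟨ *-congˡ (lagrange 1 n) ⟩
        inv (n *ℕ k) * ((1# + 0#) * (F ^S suc (n *ℕ k)) n)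
          ≈⟨ *-congˡ (trans (*-congʳ (+-identityʳ 1#)) (*-identityˡ _)) ⟩
        inv (n *ℕ k) * (F ^S suc (n *ℕ k)) n          ∎

module KCatalanPaths {c ℓ : Level} (R : CommutativeRing c ℓ) (f : ℕ → CommutativeRing.Carrier R) (k : ℕ) where
  open Series R
  open FiniteSums R
  open PowerSeries R
  open import Relation.Binary.Reasoning.Setoid setoid

  F : PS
  F = Fser f

  Σpaths : ℕ → (List Bool → Carrier) → Carrier
  Σpaths L g = sumR (map g (allPaths L))

  Σpaths-suc : ∀ L g → Σpaths (suc L) g ≈ Σpaths L (λ p → g (true ∷ p) + g (false ∷ p))
  Σpaths-suc L g = extend (allPaths L)
    where
    extend : ∀ ps → sumR (map g (concatMap (λ p → (true ∷ p) ∷ (false ∷ p) ∷ []) ps))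
                    ≈ sumR (map (λ p → g (true ∷ p) + g (false ∷ p)) ps)
    extend [] = refl
    extend (p ∷ ps) = trans (+-congˡ (+-congˡ (extend ps))) (sym (+-assoc _ _ _))

  Σpaths-cong : ∀ L {g h : List Bool → Carrier} → (∀ p → length p ≡ L → g p ≈ h p) →
    Σpaths L g ≈ Σpaths L h
  Σpaths-cong zero g≈h = +-congʳ (g≈h [] ≡.refl)
  Σpaths-cong (suc L) {g} {h} g≈h = begin
    Σpaths (suc L) g                                     ≈⟨ Σpaths-suc L g ⟩
    Σpaths L (λ p → g (true ∷ p) + g (false ∷ p))
      ≈⟨ Σpaths-cong L (λ p |p| → +-cong (g≈h _ (≡.cong suc |p|)) (g≈h _ (≡.cong suc |p|))) ⟩
    Σpaths L (λ p → h (true ∷ p) + h (false ∷ p))        ≈⟨ Σpaths-suc L h ⟨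
    Σpaths (suc L) h                                     ∎

  runWeight : ℕ → List Bool → Carrier
  runWeight a p = prodR (map f (runs a p))

  runWeight-[] : ∀ a → runWeight a [] ≈ F a
  runWeight-[] zero = refl
  runWeight-[] (suc a) = *-identityʳ _

  runWeight-false : ∀ a p → runWeight a (false ∷ p) ≈ F a * runWeight 0 p
  runWeight-false zero p = sym (*-identityˡ _)
  runWeight-false (suc a) p = refl

  -- Paths of length L from height h to 0 staying above the axis, weighted as if an up-run
  -- of length a had already been walked.
  pathSum : ℕ → ℕ → ℕ → Carrier
  pathSum h a L = Σpaths L (λ p → if staysAbove k h p then runWeight a p else 0#)

  -- The same once an up-run has ended at height h: the path stops there or steps down.
  afterRun : ℕ → ℕ → Carrier
  afterRun zero zero = 1#
  afterRun zero (suc L) = 0#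
  afterRun (suc h) zero = 0#
  afterRun (suc h) (suc L) = pathSum h 0 L

  pathSum-zero : ∀ h a → pathSum h a 0 ≈ F a * afterRun h 0
  pathSum-zero zero a = trans (+-identityʳ _) (trans (runWeight-[] a) (sym (*-identityʳ _)))
  pathSum-zero (suc h) a = trans (+-identityʳ _) (sym (zeroʳ _))

  pathSum-up : ∀ h a L →
    Σpaths L (λ p → if staysAbove k h (true ∷ p) then runWeight a (true ∷ p) else 0#) ≈ pathSum (h +ℕ k) (suc a) L
  pathSum-up zero a L = refl
  pathSum-up (suc h) a L = refl

  pathSum-down : ∀ h a L →
    Σpaths L (λ p → if staysAbove k h (false ∷ p) then runWeight a (false ∷ p) else 0#) ≈ F a * afterRun h (suc L)
  pathSum-down zero a L = trans (sumR-zero (allPaths L)) (sym (zeroʳ _))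
  pathSum-down (suc h) a L =
    trans (Σpaths-cong L (λ p _ → if-scale (staysAbove k h p) (runWeight-false a p)))
          (sym (*-distribˡ-sumR (F a) _ (allPaths L)))

  pathSum-suc : ∀ h a L → pathSum h a (suc L) ≈ pathSum (h +ℕ k) (suc a) L + F a * afterRun h (suc L)
  pathSum-suc h a L = begin
    pathSum h a (suc L)                                   ≈⟨ Σpaths-suc L summand ⟩
    Σpaths L (λ p → summand (true ∷ p) + summand (false ∷ p))
      ≈⟨ sumR-distrib-+ (λ p → summand (true ∷ p)) (λ p → summand (false ∷ p)) (allPaths L) ⟩
    Σpaths L (λ p → summand (true ∷ p)) + Σpaths L (λ p → summand (false ∷ p))
      ≈⟨ +-cong (pathSum-up h a L) (pathSum-down h a L) ⟩
    pathSum (h +ℕ k) (suc a) L + F a * afterRun h (suc L)  ∎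
    where
    summand : List Bool → Carrier
    summand p = if staysAbove k h p then runWeight a p else 0#

  pathSum-short : ∀ {h} a L → L < h → pathSum h a L ≈ 0#
  pathSum-short {suc h} a zero _ = trans (pathSum-zero (suc h) a) (zeroʳ _)
  pathSum-short {suc h} a (suc L) (s≤s L<h) = begin
    pathSum (suc h) a (suc L)                                  ≈⟨ pathSum-suc (suc h) a L ⟩
    pathSum (suc h +ℕ k) (suc a) L + F a * pathSum h 0 L
      ≈⟨ +-cong (pathSum-short (suc a) L L<h+k) (*-congˡ (pathSum-short 0 L L<h)) ⟩
    0# + F a * 0#                                               ≈⟨ trans (+-identityˡ _) (zeroʳ _) ⟩
    0#                                                          ∎
    where
    L<h+k : L < suc h +ℕ k
    L<h+k = ℕ.m≤n⇒m≤1+n (ℕ.≤-trans L<h (ℕ.m≤m+n h k))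

  afterRun-short : ∀ {h} L → L < h → afterRun h L ≈ 0#
  afterRun-short {suc h} zero _ = refl
  afterRun-short {suc h} (suc L) (s≤s L<h) = pathSum-short 0 L L<h

  pathSum-runs : ∀ L h a → pathSum h a L ≈ sumTo L (λ j → F (j +ℕ a) * afterRun (j *ℕ k +ℕ h) (L ∸ j))
  pathSum-runs zero h a = pathSum-zero h a
  pathSum-runs (suc L) h a = begin
    pathSum h a (suc L)
      ≈⟨ trans (pathSum-suc h a L) (+-comm _ _) ⟩
    F a * afterRun h (suc L) + pathSum (h +ℕ k) (suc a) L
      ≈⟨ +-congˡ (trans (pathSum-runs L (h +ℕ k) (suc a)) (sumTo-cong L (λ j _ → reflexive (reindex j)))) ⟩
    F a * afterRun h (suc L) + sumTo L (λ j → F (suc j +ℕ a) * afterRun (suc j *ℕ k +ℕ h) (L ∸ j))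
      ≈⟨ sumTo-sucˡ L _ ⟨
    sumTo (suc L) (λ j → F (j +ℕ a) * afterRun (j *ℕ k +ℕ h) (suc L ∸ j)) ∎
    where
    open +-*-Solver
    run-index : ∀ j → j *ℕ k +ℕ (h +ℕ k) ≡ suc j *ℕ k +ℕ h
    run-index j = solve 3 (λ jk h k → jk :+ (h :+ k) := (k :+ jk) :+ h) ≡.refl (j *ℕ k) h k
    reindex : ∀ j → F (j +ℕ suc a) * afterRun (j *ℕ k +ℕ (h +ℕ k)) (L ∸ j)
                    ≡ F (suc j +ℕ a) * afterRun (suc j *ℕ k +ℕ h) (L ∸ j)
    reindex j = ≡.cong₂ (λ i m → F i * afterRun m (L ∸ j)) (ℕ.+-suc j a) (run-index j)

  -- descent (h + 1) n sums the paths from height h to 0 with n up steps; descent 0 = 1.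
  descent : ℕ → PS
  descent h n = afterRun h (h +ℕ n *ℕ suc k)

  descent-zero : descent 0 ≋ oneS
  descent-zero zero = refl
  descent-zero (suc n) = refl

  descent-suc : ∀ h → descent (suc h) ≋ F ⊛ᶠ (λ j → descent (j *ℕ k +ℕ h))
  descent-suc h n = begin
    pathSum h 0 L                          ≈⟨ pathSum-runs L h 0 ⟩
    sumTo L summand                        ≈⟨ sumTo-vanishing-tail L summand n≤L tail≈0 ⟩
    sumTo n summand                        ≈⟨ sumTo-cong n (λ j j≤n → reflexive (reindex j≤n)) ⟩
    (F ⊛ᶠ (λ j → descent (j *ℕ k +ℕ h))) n ∎
    where
    L = h +ℕ n *ℕ suc k
    summand : ℕ → Carrier
    summand j = F (j +ℕ 0) * afterRun (j *ℕ k +ℕ h) (L ∸ j)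
    n≤L : n ≤ L
    n≤L = ℕ.≤-trans (ℕ.m≤m*n n (suc k)) (ℕ.m≤n+m _ h)
    tail≈0 : ∀ j → n < j → j ≤ L → summand j ≈ 0#
    tail≈0 j n<j j≤L = trans (*-congˡ (afterRun-short _ (remaining-length-short k h n<j j≤L))) (zeroʳ _)
    reindex : ∀ {j} → j ≤ n → summand j ≡ F j * descent (j *ℕ k +ℕ h) (n ∸ j)
    reindex {j} j≤n =
      ≡.cong₂ (λ i m → F i * afterRun (j *ℕ k +ℕ h) m) (ℕ.+-identityʳ j) (remaining-length k h j≤n)

  cSeq-descent : cSeq f k ≋ descent 1
  cSeq-descent n = begin
    cSeq f k n
      ≈⟨ sumR-filterᵇ (isCatalan k n) (weight f) (allPaths L) ⟩
    Σpaths L (λ p → if isCatalan k n p then weight f p else 0#)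
      ≈⟨ Σpaths-cong L (λ p |p|≡L → reflexive (≡.cong (λ b → if b ∧ staysAbove k 0 p then weight f p else 0#)
                                                       (length-test {p} |p|≡L))) ⟩
    pathSum 0 0 L
      ≡⟨ ≡.cong (pathSum 0 0) (ℕ.*-comm (suc k) n) ⟩
    descent 1 n ∎
    where
    L = suc k *ℕ n
    length-test : ∀ {p : List Bool} → length p ≡ L → (length p ≡ᵇ L) ≡ true
    length-test {p} |p|≡L = Equivalence.to T-≡ (ℕ.≡⇒≡ᵇ (length p) L |p|≡L)

theorem3p1 : {c ℓ : Level} (R : CommutativeRing c ℓ)
  → let open Series R in
    (inv : ℕ → Carrier) → (∀ m → inv m * fromℕ (suc m) ≈ 1#)
  → (f : ℕ → Carrier) → (k : ℕ) → 1 ≤ k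
  → (∀ n → cSeq f k n ≈ inv (k *ℕ n) * ((Fser f ^S suc (k *ℕ n)) n))
    × (∀ n → cSeq f k n ≈ compose (Fser f) (shiftX (cSeq f k ^S k)) n)
theorem3p1 R inv inv-correct f k 1≤k = coefficients , functional-equation
  where
  open Series R
  open PowerSeries R
  open KCatalanPaths R f k
  open Recursion.Solution R F k descent descent-zero descent-suc
  open import Relation.Binary.Reasoning.Setoid setoid

  coefficients : ∀ n → cSeq f k n ≈ inv (k *ℕ n) * (F ^S suc (k *ℕ n)) n
  coefficients n = trans (cSeq-descent n) (Lagrange.A₁-coefficient inv inv-correct 1≤k n)

  functional-equation : ∀ n → cSeq f k n ≈ compose F (shiftX (cSeq f k ^S k)) n
  functional-equation n = begin
    cSeq f k n                             ≈⟨ cSeq-descent n ⟩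
    descent 1 n                            ≈⟨ A₁-functional-equation n ⟩
    compose F (shiftX (descent 1 ^S k)) n
      ≈⟨ compose-congʳ F (shiftX-cong (^S-cong k (λ m → sym (cSeq-descent m)))) n ⟩
    compose F (shiftX (cSeq f k ^S k)) n   ∎
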